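{- Let $n\ge1$ and let $A$ be a real $n\times n$ matrix such that $n-1$ of its rows are identical. Then $\operatorname{dih}(A)=0$.
   Context: For $n\ge1$ and $k=1,\dots,n$, let $\rho_k$ be the permutation of $\{1,\dots,n\}$ with $\rho_k(1)=k,\rho_k(2)=k+1,\dots,\rho_k(n-k+1)=n,\rho_k(n-k+2)=1,\dots,\rho_k(n)=k-1$, and let $\mu_k$ be the permutation with $\mu_k(1)=k,\mu_k(2)=k-1,\dots,\mu_k(k)=1,\mu_k(k+1)=n,\mu_k(k+2)=n-1,\dots,\mu_k(n)=k+1$. For an $n\times n$ matrix $A=(a_{i,j})$, the dihedrant is $$\operatorname{dih}(A)=\sum_{k=1}^n\prod_{i=1}^n a_{i,\rho_k(i)}-\sum_{k=1}^n\prod_{i=1}^n a_{i,\mu_k(i)}.$$ -}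

module Defs where

open import Level using (Level)
open import Algebra.Bundles using (CommutativeRing)
open import Data.Nat using (ℕ; zero; suc; _∸_; _%_) renaming (_+_ to _+ℕ_)
open import Data.Nat.DivMod using (m%n<n)
open import Data.Fin using (Fin; toℕ; fromℕ<)
import Data.Fin as Fin
open import Data.Product using (∃; _×_)
open import Relation.Binary.PropositionalEquality using (_≢_)

-- 0-based versions of the paper's permutations of {1,…,n}.
-- With indices i, k ∈ {0,…,n-1} (paper's i+1, k+1):
--   rho k i = (i + k) mod n          (paper: ρ_{k+1}(i+1) - 1)
--   mu  k i = (k - i) mod n          (paper: μ_{k+1}(i+1) - 1)
--           = k - i        if i ≤ k
--           = n + k - i    if i > k
rho : (m : ℕ) → Fin (suc m) → Fin (suc m) → Fin (suc m)
rho m k i = fromℕ< (m%n<n (toℕ i +ℕ toℕ k) (suc m))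

mu : (m : ℕ) → Fin (suc m) → Fin (suc m) → Fin (suc m)
mu m k i = fromℕ< (m%n<n ((suc m +ℕ toℕ k) ∸ toℕ i) (suc m))

module _ {c ℓ : Level} (R : CommutativeRing c ℓ) where
  open CommutativeRing R

  Matrix : ℕ → Set c
  Matrix n = Fin n → Fin n → Carrier

  Σ[_] : (n : ℕ) → (Fin n → Carrier) → Carrier
  Σ[ zero ] f = 0#
  Σ[ suc n ] f = f Fin.zero + Σ[ n ] (λ i → f (Fin.suc i))

  Π[_] : (n : ℕ) → (Fin n → Carrier) → Carrier
  Π[ zero ] f = 1#
  Π[ suc n ] f = f Fin.zero * Π[ n ] (λ i → f (Fin.suc i))

  -- the dihedrant (for n = 0 both sums are empty, so it is 0)
  dih : (n : ℕ) → Matrix n → Carrier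
  dih zero A = 0#
  dih (suc m) A =
    Σ[ suc m ] (λ k → Π[ suc m ] (λ i → A i (rho m k i)))
    - Σ[ suc m ] (λ k → Π[ suc m ] (λ i → A i (mu m k i)))

  NMinusOneRowsIdentical : (n : ℕ) → Matrix n → Set ℓ
  NMinusOneRowsIdentical n A =
    ∃ λ (r : Fin n) → ∀ (i j : Fin n) → i ≢ r → j ≢ r → ∀ (col : Fin n) → A i col ≈ A j col

-- Say all rows other than row r coincide.  Then a diagonal product
-- ∏ᵢ A i (σ i) along a permutation σ depends only on σ r: reading the
-- product column by column, column j meets row σ⁻¹ j, and that row is r
-- exactly when j = σ r, while every other column meets the common row.
--
-- Indices are read modulo n, where ρₖ i = i + k and μₖ i = k - i.  Both
-- are permutations (μₖ is an involution; ρₖ has inverse ρ₋ₖ), and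
-- μ_{k+2r} r = k + r = ρₖ r.  So reindexing the μ-half of the dihedrant
-- along the permutation k ↦ k + 2r matches it, term by term, with the
-- ρ-half, and the two halves cancel.
module Submission where

open import Defs
open import Level using (Level; 0ℓ)
open import Algebra.Bundles using (CommutativeRing; CommutativeMonoid)
open import Relation.Binary.Bundles using (Setoid)
open import Data.Nat using (ℕ; zero; suc; _+_; _∸_; _%_; _≤_)
open import Data.Nat.Properties
  using (+-comm; +-assoc; +-identityʳ; m∸n+n≡m; m+[n∸m]≡n; ≤-trans; m≤m+n; <⇒≤)
open import Data.Nat.DivMod
  using (%-distribˡ-+; m%n%n≡m%n; [m+n]%n≡m%n; m<n⇒m%n≡m; n%n≡0; m%n≤n)
open import Data.Fin as Fin using (Fin; toℕ; _≟_)
open import Data.Fin.Properties using (toℕ-fromℕ<; toℕ-injective; toℕ<n)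
open import Data.Fin.Permutation
  using (Permutation′; permutation; _⟨$⟩ʳ_; _⟨$⟩ˡ_; inverseˡ; inverseʳ; flip)
open import Data.Product using (_,_)
open import Function using (_∘_)
open import Relation.Binary.PropositionalEquality
  using (_≡_; _≢_; refl; sym; trans; cong; cong₂; module ≡-Reasoning)
open import Relation.Nullary using (yes; no)
import Algebra.Properties.CommutativeMonoid.Sum as BigOp
import Relation.Binary.Reasoning.Setoid as SetoidReasoning

module Cyclic (m : ℕ) where

  private
    n : ℕ
    n = suc m

  -- Congruence modulo n.  It is a record (rather than the bare equation
  -- a % n ≡ b % n) so that a and b can be inferred from a proof.
  infix 4 _≡ₙ_
  record _≡ₙ_ (a b : ℕ) : Set where
    constructor mod-eq
    field residue-eq : a % n ≡ b % n
  open _≡ₙ_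

  ≡ₙ-setoid : Setoid 0ℓ 0ℓ
  ≡ₙ-setoid = record
    { Carrier       = ℕ
    ; _≈_           = _≡ₙ_
    ; isEquivalence = record
      { refl  = mod-eq refl
      ; sym   = λ a≡b → mod-eq (sym (residue-eq a≡b))
      ; trans = λ a≡b b≡c → mod-eq (trans (residue-eq a≡b) (residue-eq b≡c))
      }
    }

  open SetoidReasoning ≡ₙ-setoid

  %-≡ₙ : ∀ a → a % n ≡ₙ a
  %-≡ₙ a = mod-eq (m%n%n≡m%n a n)

  +-≡ₙ-cong : ∀ {a b c d} → a ≡ₙ b → c ≡ₙ d → a + c ≡ₙ b + d
  +-≡ₙ-cong {a} {b} {c} {d} (mod-eq a≡b) (mod-eq c≡d) = mod-eq
    (trans (%-distribˡ-+ a c n)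
      (trans (cong₂ (λ x y → (x + y) % n) a≡b c≡d) (sym (%-distribˡ-+ b d n))))

  +-≡ₙ-congˡ : ∀ c {a b} → a ≡ₙ b → a + c ≡ₙ b + c
  +-≡ₙ-congˡ c a≡b = +-≡ₙ-cong a≡b (mod-eq {c} refl)

  +-≡ₙ-congʳ : ∀ a {c d} → c ≡ₙ d → a + c ≡ₙ a + d
  +-≡ₙ-congʳ a c≡d = +-≡ₙ-cong (mod-eq {a} refl) c≡d

  +-≡ₙ-inverse : ∀ c → c + (n ∸ c % n) ≡ₙ 0
  +-≡ₙ-inverse c = begin
    c + (n ∸ c % n)           ≈⟨ +-≡ₙ-congˡ (n ∸ c % n) (%-≡ₙ c) ⟨
    c % n + (n ∸ c % n)       ≡⟨ m+[n∸m]≡n (m%n≤n c n) ⟩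
    n                         ≈⟨ mod-eq (n%n≡0 n) ⟩
    0                         ∎

  +-≡ₙ-cancelʳ : ∀ {a b} c → a + c ≡ₙ b + c → a ≡ₙ b
  +-≡ₙ-cancelʳ {a} {b} c a+c≡b+c = begin
    a                         ≡⟨ +-identityʳ a ⟨
    a + 0                     ≈⟨ +-≡ₙ-congʳ a (+-≡ₙ-inverse c) ⟨
    a + (c + c⁻)              ≡⟨ +-assoc a c c⁻ ⟨
    a + c + c⁻                ≈⟨ +-≡ₙ-congˡ c⁻ a+c≡b+c ⟩
    b + c + c⁻                ≡⟨ +-assoc b c c⁻ ⟩
    b + (c + c⁻)              ≈⟨ +-≡ₙ-congʳ b (+-≡ₙ-inverse c) ⟩
    b + 0                     ≡⟨ +-identityʳ b ⟩
    b                         ∎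
    where
    c⁻ : ℕ
    c⁻ = n ∸ c % n

  toℕ-≡ₙ-injective : ∀ {a b : Fin n} → toℕ a ≡ₙ toℕ b → a ≡ b
  toℕ-≡ₙ-injective {a} {b} (mod-eq a≡b) =
    toℕ-injective (trans (sym (m<n⇒m%n≡m (toℕ<n a))) (trans a≡b (m<n⇒m%n≡m (toℕ<n b))))

  rho-spec : ∀ k i → toℕ (rho m k i) ≡ₙ toℕ i + toℕ k
  rho-spec k i = begin
    toℕ (rho m k i)           ≡⟨ toℕ-fromℕ< _ ⟩
    (toℕ i + toℕ k) % n       ≈⟨ %-≡ₙ _ ⟩
    toℕ i + toℕ k             ∎

  mu-spec : ∀ k i → toℕ (mu m k i) + toℕ i ≡ₙ toℕ k
  mu-spec k i = begin
    toℕ (mu m k i) + I        ≡⟨ cong (_+ I) (toℕ-fromℕ< _) ⟩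
    (n + K ∸ I) % n + I       ≈⟨ +-≡ₙ-congˡ I (%-≡ₙ (n + K ∸ I)) ⟩
    n + K ∸ I + I             ≡⟨ m∸n+n≡m i≤n+k ⟩
    n + K                     ≡⟨ +-comm n K ⟩
    K + n                     ≈⟨ mod-eq ([m+n]%n≡m%n K n) ⟩
    K                         ∎
    where
    I K : ℕ
    I = toℕ i
    K = toℕ k
    i≤n+k : I ≤ n + K
    i≤n+k = ≤-trans (<⇒≤ (toℕ<n i)) (m≤m+n n K)

  mu-involutive : ∀ k i → mu m k (mu m k i) ≡ i
  mu-involutive k i = toℕ-≡ₙ-injective (+-≡ₙ-cancelʳ (toℕ (mu m k i)) (begin
    toℕ (mu m k (mu m k i)) + toℕ (mu m k i) ≈⟨ mu-spec k (mu m k i) ⟩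
    toℕ k                                    ≈⟨ mu-spec k i ⟨
    toℕ (mu m k i) + toℕ i                   ≡⟨ +-comm (toℕ (mu m k i)) (toℕ i) ⟩
    toℕ i + toℕ (mu m k i)                   ∎))

  muP : Fin n → Permutation′ n
  muP k = permutation (mu m k) (mu m k) (mu-involutive k) (mu-involutive k)

  -- ρ_b followed by ρ_a is ρ_{b+a}; so ρ_a undoes ρ_b when b + a ≡ 0.
  -- Taking -k = μ₀ k makes ρₖ a permutation with inverse ρ₋ₖ.
  rho-rho : ∀ a b i → toℕ (rho m a (rho m b i)) ≡ₙ toℕ i + (toℕ b + toℕ a)
  rho-rho a b i = begin
    toℕ (rho m a (rho m b i)) ≈⟨ rho-spec a (rho m b i) ⟩
    toℕ (rho m b i) + toℕ a   ≈⟨ +-≡ₙ-congˡ (toℕ a) (rho-spec b i) ⟩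
    toℕ i + toℕ b + toℕ a     ≡⟨ +-assoc (toℕ i) (toℕ b) (toℕ a) ⟩
    toℕ i + (toℕ b + toℕ a)   ∎

  rho-cancel : ∀ a b i → toℕ b + toℕ a ≡ₙ 0 → rho m a (rho m b i) ≡ i
  rho-cancel a b i b+a≡0 = toℕ-≡ₙ-injective (begin
    toℕ (rho m a (rho m b i)) ≈⟨ rho-rho a b i ⟩
    toℕ i + (toℕ b + toℕ a)   ≈⟨ +-≡ₙ-congʳ (toℕ i) b+a≡0 ⟩
    toℕ i + 0                 ≡⟨ +-identityʳ (toℕ i) ⟩
    toℕ i                     ∎)

  rhoP : Fin n → Permutation′ n
  rhoP k = permutation (rho m k) (rho m -k)
    (λ j → rho-cancel k -k j (mu-spec Fin.zero k))
    (λ i → rho-cancel -k k i (begin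
      toℕ k + toℕ -k          ≡⟨ +-comm (toℕ k) (toℕ -k) ⟩
      toℕ -k + toℕ k          ≈⟨ mu-spec Fin.zero k ⟩
      0                       ∎))
    where
    -k : Fin n
    -k = mu m Fin.zero k

  -- The shift permutation k ↦ k + 2r aligns the μ- and ρ-diagonals at r:
  -- μ_{k+2r} r = k + r = ρₖ r.
  shift : Fin n → Permutation′ n
  shift r = rhoP (rho m r r)

  mu-shift : ∀ r k → mu m (shift r ⟨$⟩ʳ k) r ≡ rho m k r
  mu-shift r k = toℕ-≡ₙ-injective (+-≡ₙ-cancelʳ R (begin
    toℕ (mu m φk r) + R       ≈⟨ mu-spec φk r ⟩
    toℕ φk                    ≈⟨ rho-spec (rho m r r) k ⟩
    K + toℕ (rho m r r)       ≈⟨ +-≡ₙ-congʳ K (rho-spec r r) ⟩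
    K + (R + R)               ≡⟨ +-assoc K R R ⟨
    K + R + R                 ≡⟨ cong (_+ R) (+-comm K R) ⟩
    R + K + R                 ≈⟨ +-≡ₙ-congˡ R (rho-spec k r) ⟨
    toℕ (rho m k r) + R       ∎))
    where
    φk : Fin n
    φk = shift r ⟨$⟩ʳ k
    R K : ℕ
    R = toℕ r
    K = toℕ k

same-preimage-of : ∀ {n} (r : Fin n) (σ π : Permutation′ n) → σ ⟨$⟩ʳ r ≡ π ⟨$⟩ʳ r →
  ∀ {j} → σ ⟨$⟩ˡ j ≡ r → π ⟨$⟩ˡ j ≡ r
same-preimage-of r σ π σr≡πr {j} σ⁻¹j≡r = begin
  π ⟨$⟩ˡ j                       ≡⟨ cong (π ⟨$⟩ˡ_) (inverseʳ σ) ⟨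
  π ⟨$⟩ˡ (σ ⟨$⟩ʳ (σ ⟨$⟩ˡ j))     ≡⟨ cong (λ x → π ⟨$⟩ˡ (σ ⟨$⟩ʳ x)) σ⁻¹j≡r ⟩
  π ⟨$⟩ˡ (σ ⟨$⟩ʳ r)              ≡⟨ cong (π ⟨$⟩ˡ_) σr≡πr ⟩
  π ⟨$⟩ˡ (π ⟨$⟩ʳ r)              ≡⟨ inverseˡ π ⟩
  r                              ∎
  where open ≡-Reasoning

-- Diagonal products of a matrix whose rows agree outside one row, in an
-- arbitrary commutative monoid (written multiplicatively in the comments,
-- with ∏ the library's big operator `sum`).
module DiagonalProducts {c ℓ : Level} (M : CommutativeMonoid c ℓ) where
  open CommutativeMonoid M using (Carrier; _≈_; setoid; reflexive)
  open BigOp M using (sum; sum-permute; sum-cong-≗; sum-cong-≋)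
  open SetoidReasoning setoid

  RowsAgreeOutside : ∀ {n} → (Fin n → Fin n → Carrier) → Fin n → Set ℓ
  RowsAgreeOutside {n} f r = ∀ (i j : Fin n) → i ≢ r → j ≢ r → ∀ col → f i col ≈ f j col

  diagonal-by-columns : ∀ {n} (f : Fin n → Fin n → Carrier) (σ : Permutation′ n) →
    sum (λ i → f i (σ ⟨$⟩ʳ i)) ≈ sum (λ j → f (σ ⟨$⟩ˡ j) j)
  diagonal-by-columns f σ = begin
    sum (λ i → f i (σ ⟨$⟩ʳ i))                       ≈⟨ sum-permute _ (flip σ) ⟩
    sum (λ j → f (σ ⟨$⟩ˡ j) (σ ⟨$⟩ʳ (σ ⟨$⟩ˡ j)))     ≡⟨ sum-cong-≗ (λ j → cong (f (σ ⟨$⟩ˡ j)) (inverseʳ σ)) ⟩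
    sum (λ j → f (σ ⟨$⟩ˡ j) j)                       ∎

  diagonal-depends-only-on : ∀ {n} (f : Fin n → Fin n → Carrier) (r : Fin n) →
    RowsAgreeOutside f r → (σ π : Permutation′ n) → σ ⟨$⟩ʳ r ≡ π ⟨$⟩ʳ r →
    sum (λ i → f i (σ ⟨$⟩ʳ i)) ≈ sum (λ i → f i (π ⟨$⟩ʳ i))
  diagonal-depends-only-on f r agree σ π σr≡πr = begin
    sum (λ i → f i (σ ⟨$⟩ʳ i))     ≈⟨ diagonal-by-columns f σ ⟩
    sum (λ j → f (σ ⟨$⟩ˡ j) j)     ≈⟨ sum-cong-≋ same-column ⟩
    sum (λ j → f (π ⟨$⟩ˡ j) j)     ≈⟨ diagonal-by-columns f π ⟨
    sum (λ i → f i (π ⟨$⟩ʳ i))     ∎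
    where
    same-column : ∀ j → f (σ ⟨$⟩ˡ j) j ≈ f (π ⟨$⟩ˡ j) j
    same-column j with σ ⟨$⟩ˡ j ≟ r
    ... | yes σ⁻¹j≡r = reflexive (cong (λ x → f x j)
                         (trans σ⁻¹j≡r (sym (same-preimage-of r σ π σr≡πr σ⁻¹j≡r))))
    ... | no σ⁻¹j≢r  = agree _ _ σ⁻¹j≢r (σ⁻¹j≢r ∘ same-preimage-of r π σ (sym σr≡πr)) j

module Dihedrant {c ℓ : Level} (R : CommutativeRing c ℓ) where
  open CommutativeRing R
    using (Carrier; _≈_; setoid; +-commutativeMonoid; *-commutativeMonoid)
  open DiagonalProducts *-commutativeMonoid using (RowsAgreeOutside; diagonal-depends-only-on)
  open SetoidReasoning setoid
  module ∏ = BigOp *-commutativeMonoid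
  module ∑ = BigOp +-commutativeMonoid

  Π-as-product : ∀ n (f : Fin n → Carrier) → Π[_] R n f ≡ ∏.sum f
  Π-as-product zero    f = refl
  Π-as-product (suc n) f = cong (CommutativeRing._*_ R (f Fin.zero)) (Π-as-product n (f ∘ Fin.suc))

  Σ-as-sum : ∀ n (f : Fin n → Carrier) → Σ[_] R n f ≡ ∑.sum f
  Σ-as-sum zero    f = refl
  Σ-as-sum (suc n) f = cong (CommutativeRing._+_ R (f Fin.zero)) (Σ-as-sum n (f ∘ Fin.suc))

  rho-diagonal mu-diagonal : ∀ m → Matrix R (suc m) → Fin (suc m) → Carrier
  rho-diagonal m A k = Π[_] R (suc m) (λ i → A i (rho m k i))
  mu-diagonal  m A k = Π[_] R (suc m) (λ i → A i (mu m k i))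

  -- If the rows of A agree outside row r, the μ_{k+2r}-diagonal equals
  -- the ρₖ-diagonal, since both permutations send r to k + r.
  mu-shift-diagonal : ∀ m (A : Matrix R (suc m)) r → RowsAgreeOutside A r → ∀ k →
    mu-diagonal m A (Cyclic.shift m r ⟨$⟩ʳ k) ≈ rho-diagonal m A k
  mu-shift-diagonal m A r agree k = begin
    mu-diagonal m A φk                        ≡⟨ Π-as-product (suc m) (λ i → A i (mu m φk i)) ⟩
    ∏.sum (λ i → A i (muP φk ⟨$⟩ʳ i))        ≈⟨ diagonal-depends-only-on A r agree (muP φk) (rhoP k)
                                                   (mu-shift r k) ⟩
    ∏.sum (λ i → A i (rhoP k ⟨$⟩ʳ i))        ≡⟨ Π-as-product (suc m) (λ i → A i (rho m k i)) ⟨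
    rho-diagonal m A k                        ∎
    where
    open Cyclic m using (muP; rhoP; shift; mu-shift)
    φk : Fin (suc m)
    φk = shift r ⟨$⟩ʳ k

  -- Hence the μ-half of the dihedrant equals the ρ-half: reindex it
  -- along the permutation k ↦ k + 2r.
  halves-agree : ∀ m (A : Matrix R (suc m)) r → RowsAgreeOutside A r →
    Σ[_] R (suc m) (mu-diagonal m A) ≈ Σ[_] R (suc m) (rho-diagonal m A)
  halves-agree m A r agree = begin
    Σ[_] R (suc m) (mu-diagonal m A)                         ≡⟨ Σ-as-sum (suc m) (mu-diagonal m A) ⟩
    ∑.sum (mu-diagonal m A)                                  ≈⟨ ∑.sum-permute (mu-diagonal m A) (Cyclic.shift m r) ⟩
    ∑.sum (λ k → mu-diagonal m A (Cyclic.shift m r ⟨$⟩ʳ k)) ≈⟨ ∑.sum-cong-≋ (mu-shift-diagonal m A r agree) ⟩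
    ∑.sum (rho-diagonal m A)                                 ≡⟨ Σ-as-sum (suc m) (rho-diagonal m A) ⟨
    Σ[_] R (suc m) (rho-diagonal m A)                        ∎

theorem5 : {c ℓ : Level} (R : CommutativeRing c ℓ) (n : ℕ) → 1 ≤ n →
    (A : Matrix R n) → NMinusOneRowsIdentical R n A →
    CommutativeRing._≈_ R (dih R n A) (CommutativeRing.0# R)
theorem5 R (suc m) _ A (r , agree) = begin
  dih R (suc m) A   ≡⟨⟩
  Σρ - Σμ           ≈⟨ +-congˡ (-‿cong (halves-agree m A r agree)) ⟩
  Σρ - Σρ           ≈⟨ -‿inverseʳ Σρ ⟩
  0#                ∎
  where
  open CommutativeRing R using (Carrier; _-_; 0#; setoid; +-congˡ; -‿cong; -‿inverseʳ)
  open Dihedrant R using (rho-diagonal; mu-diagonal; halves-agree)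
  open SetoidReasoning setoid
  Σρ Σμ : Carrier
  Σρ = Σ[_] R (suc m) (rho-diagonal m A)
  Σμ = Σ[_] R (suc m) (mu-diagonal m A)
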